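{- For every positive integer $s$, the elementary abelian $2$-group $\mathbb{Z}_2^{2s}$ has a perfect restricted $s$-basis of size $2s+1$.
   Context: A subset $A$ of a finite abelian group $G$ is a perfect restricted $s$-basis of $G$ if every element of $G$ can be written as a sum of at most $s$ pairwise distinct elements of $A$ (the empty sum giving $0$), and this representation is unique apart from the order of the terms; equivalently, the sums $\sum_{a\in S}a$ over subsets $S\subseteq A$ with $|S|\le s$ are pairwise distinct and cover $G$. $\mathbb{Z}_n=\mathbb{Z}/n\mathbb{Z}$. -}

module Defs where

open import Data.Nat using (ℕ; zero; suc; _≤_)
open import Data.Bool using (Bool; true; false; _xor_)
open import Data.Vec using (Vec; []; _∷_; zipWith; replicate)
open import Data.Fin using (Fin)
import Data.Fin as F
open import Data.Fin.Subset using (Subset; ∣_∣)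
open import Data.Product using (Σ; _×_)
open import Relation.Binary.PropositionalEquality using (_≡_)
open import Function.Definitions using (Injective)

Z2^ : ℕ → Set
Z2^ n = Vec Bool n

_⊕_ : {n : ℕ} → Z2^ n → Z2^ n → Z2^ n
_⊕_ = zipWith _xor_

𝟘 : {n : ℕ} → Z2^ n
𝟘 {n} = replicate n false

subsetSum : {m n : ℕ} → (Fin m → Z2^ n) → Subset m → Z2^ n
subsetSum {zero}  a []          = 𝟘
subsetSum {suc m} a (true ∷ S)  = a F.zero ⊕ subsetSum (λ i → a (F.suc i)) S
subsetSum {suc m} a (false ∷ S) = subsetSum (λ i → a (F.suc i)) S

-- A set A = {a i | i : Fin m} of m distinct elements (a injective) is a perfect
-- restricted s-basis of Z_2^n: every g is the sum of a subset of A of size ≤ s,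
-- and this subset is unique.
IsPerfectRestrictedBasis : {m n : ℕ} → ℕ → (Fin m → Z2^ n) → Set
IsPerfectRestrictedBasis {m} {n} s a =
  Injective _≡_ _≡_ a
  × ((g : Z2^ n) → Σ (Subset m) (λ S → (∣ S ∣ ≤ s) × (subsetSum a S ≡ g)))
  × ((S T : Subset m) → ∣ S ∣ ≤ s → ∣ T ∣ ≤ s → subsetSum a S ≡ subsetSum a T → S ≡ T)

-- The basis consists of the 2s unit vectors together with the all-ones vector.
-- A subset of the unit vectors sums to its own indicator vector; adding the
-- all-ones vector complements it. So g is represented by g itself if it has
-- weight ≤ s, and otherwise by the all-ones vector plus the complement of g,
-- which uses 1 + (2s − |g|) ≤ s elements. Uniqueness: two representations
-- with and without the all-ones vector would give a set S with |S| < s and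
-- |∁ S| ≤ s, whose weights cannot add up to 2s.
-- Vectors in Z_2^n and subsets of Fin n are the same type, so ⁅_⁆, ∁ and ⊤ of
-- Data.Fin.Subset serve as unit vectors, complement and all-ones vector.
module Submission where

open import Defs
open import Data.Nat using (ℕ; zero; suc; _*_; _≤_; _+_; _<_)
open import Data.Fin using (Fin)
open import Data.Product using (Σ; _,_; _×_)
open import Data.Nat.Properties
  using ( ≤-trans; ≤-reflexive; <-irrefl; _≤?_; ≰⇒>; m∸n+n≡m; +-identityʳ; +-suc; +-comm
        ; +-monoˡ-≤; +-mono-≤; +-mono-≤-<; +-cancelˡ-≤; module ≤-Reasoning)
import Data.Fin as F
open import Data.Bool using (true; false; not)
open import Data.Bool.Properties using (not-involutive)
open import Data.Vec using ([]; _∷_)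
open import Data.Vec.Properties using (map-∘; map-cong; map-id)
open import Data.Fin.Subset using (Subset; ∣_∣; ∁; ⊤; ⁅_⁆; _∈_)
open import Data.Fin.Subset.Properties
  using (∣⊤∣≡n; ∣⁅x⁆∣≡1; x∈⁅x⁆; x∈⁅y⁆⇒x≡y; ∣∁p∣≡n∸∣p∣; ∣p∣≤n)
open import Function.Definitions using (Injective)
open import Relation.Binary.PropositionalEquality
open import Relation.Nullary using (¬_; yes; no; contradiction)

private
  variable
    n : ℕ

𝟘-⊕ : (x : Z2^ n) → 𝟘 ⊕ x ≡ x
𝟘-⊕ []      = refl
𝟘-⊕ (b ∷ x) = cong (b ∷_) (𝟘-⊕ x)

⊤-⊕ : (x : Z2^ n) → ⊤ ⊕ x ≡ ∁ x
⊤-⊕ []      = refl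
⊤-⊕ (b ∷ x) = cong (not b ∷_) (⊤-⊕ x)

∁-involutive : (p : Subset n) → ∁ (∁ p) ≡ p
∁-involutive p = trans (sym (map-∘ not not p)) (trans (map-cong not-involutive p) (map-id p))

∁-injective : {p q : Subset n} → ∁ p ≡ ∁ q → p ≡ q
∁-injective {p = p} {q} eq = trans (sym (∁-involutive p)) (trans (cong ∁ eq) (∁-involutive q))

∣∁p∣+∣p∣≡n : (p : Subset n) → ∣ ∁ p ∣ + ∣ p ∣ ≡ n
∣∁p∣+∣p∣≡n p rewrite ∣∁p∣≡n∸∣p∣ p = m∸n+n≡m (∣p∣≤n p)

⁅⁆-injective : Injective _≡_ _≡_ (⁅_⁆ {n})
⁅⁆-injective {x = i} {y = j} eq = x∈⁅y⁆⇒x≡y j (subst (i ∈_) eq (x∈⁅x⁆ i))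

subsetSum-prependFalse : {m : ℕ} (f : Fin m → Z2^ n) (S : Subset m) →
  subsetSum (λ i → false ∷ f i) S ≡ false ∷ subsetSum f S
subsetSum-prependFalse {m = zero} f []  = refl
subsetSum-prependFalse {m = suc m} f (true ∷ S) =
  cong ((false ∷ f F.zero) ⊕_) (subsetSum-prependFalse (λ i → f (F.suc i)) S)
subsetSum-prependFalse {m = suc m} f (false ∷ S) =
  subsetSum-prependFalse (λ i → f (F.suc i)) S

subsetSum-⁅⁆ : (S : Subset n) → subsetSum ⁅_⁆ S ≡ S
subsetSum-⁅⁆ []          = refl
subsetSum-⁅⁆ (true ∷ S)  = begin
  (true ∷ 𝟘) ⊕ subsetSum (λ i → false ∷ ⁅ i ⁆) S  ≡⟨ cong ((true ∷ 𝟘) ⊕_) (subsetSum-prependFalse ⁅_⁆ S) ⟩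
  true ∷ (𝟘 ⊕ subsetSum ⁅_⁆ S)                    ≡⟨ cong (true ∷_) (𝟘-⊕ _) ⟩
  true ∷ subsetSum ⁅_⁆ S                          ≡⟨ cong (true ∷_) (subsetSum-⁅⁆ S) ⟩
  true ∷ S                                        ∎
  where open ≡-Reasoning
subsetSum-⁅⁆ (false ∷ S) = begin
  subsetSum (λ i → false ∷ ⁅ i ⁆) S  ≡⟨ subsetSum-prependFalse ⁅_⁆ S ⟩
  false ∷ subsetSum ⁅_⁆ S            ≡⟨ cong (false ∷_) (subsetSum-⁅⁆ S) ⟩
  false ∷ S                          ∎
  where open ≡-Reasoning

allOnesAndUnits : (n : ℕ) → Fin (suc n) → Z2^ n
allOnesAndUnits n F.zero    = ⊤
allOnesAndUnits n (F.suc i) = ⁅ i ⁆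

⊤≢⁅⁆ : 2 ≤ n → (i : Fin n) → ⊤ ≢ ⁅ i ⁆
⊤≢⁅⁆ {n} 2≤n i eq = <-irrefl refl (subst (2 ≤_) n≡1 2≤n)
  where
  n≡1 : n ≡ 1
  n≡1 = trans (sym (∣⊤∣≡n n)) (trans (cong ∣_∣ eq) (∣⁅x⁆∣≡1 i))

allOnesAndUnits-injective : 2 ≤ n → Injective _≡_ _≡_ (allOnesAndUnits n)
allOnesAndUnits-injective 2≤n {F.zero}  {F.zero}  _  = refl
allOnesAndUnits-injective 2≤n {F.zero}  {F.suc j} eq = contradiction eq (⊤≢⁅⁆ 2≤n j)
allOnesAndUnits-injective 2≤n {F.suc i} {F.zero}  eq = contradiction (sym eq) (⊤≢⁅⁆ 2≤n i)
allOnesAndUnits-injective 2≤n {F.suc i} {F.suc j} eq = cong F.suc (⁅⁆-injective eq)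

subsetSum-allOnesAndUnits-false : (S : Subset n) → subsetSum (allOnesAndUnits n) (false ∷ S) ≡ S
subsetSum-allOnesAndUnits-false = subsetSum-⁅⁆

subsetSum-allOnesAndUnits-true : (S : Subset n) → subsetSum (allOnesAndUnits n) (true ∷ S) ≡ ∁ S
subsetSum-allOnesAndUnits-true S = trans (cong (⊤ ⊕_) (subsetSum-⁅⁆ S)) (⊤-⊕ S)

module _ {s : ℕ} where

  ∁-small-if-large : n ≤ s + s → (g : Subset n) → s < ∣ g ∣ → suc ∣ ∁ g ∣ ≤ s
  ∁-small-if-large {n} n≤2s g s<∣g∣ = +-cancelˡ-≤ s _ _ (begin
    s + suc ∣ ∁ g ∣    ≡⟨ +-suc s _ ⟩
    suc s + ∣ ∁ g ∣    ≤⟨ +-monoˡ-≤ _ s<∣g∣ ⟩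
    ∣ g ∣ + ∣ ∁ g ∣    ≡⟨ +-comm ∣ g ∣ _ ⟩
    ∣ ∁ g ∣ + ∣ g ∣    ≡⟨ ∣∁p∣+∣p∣≡n g ⟩
    n                  ≤⟨ n≤2s ⟩
    s + s              ∎)
    where open ≤-Reasoning

  ∁-not-both-small : s + s ≤ n → (S : Subset n) → ∣ S ∣ < s → ¬ ∣ ∁ S ∣ ≤ s
  ∁-not-both-small {n} 2s≤n S ∣S∣<s ∣∁S∣≤s = <-irrefl refl (begin-strict
    s + s              ≤⟨ 2s≤n ⟩
    n                  ≡⟨ sym (∣∁p∣+∣p∣≡n S) ⟩
    ∣ ∁ S ∣ + ∣ S ∣    <⟨ +-mono-≤-< ∣∁S∣≤s ∣S∣<s ⟩
    s + s              ∎)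
    where open ≤-Reasoning

  allOnesAndUnits-covers : n ≤ s + s → (g : Z2^ n) →
    Σ (Subset (suc n)) (λ S → (∣ S ∣ ≤ s) × (subsetSum (allOnesAndUnits n) S ≡ g))
  allOnesAndUnits-covers n≤2s g with ∣ g ∣ ≤? s
  ... | yes ∣g∣≤s = false ∷ g , ∣g∣≤s , subsetSum-allOnesAndUnits-false g
  ... | no ∣g∣≰s  = true ∷ ∁ g , ∁-small-if-large n≤2s g (≰⇒> ∣g∣≰s) ,
                    trans (subsetSum-allOnesAndUnits-true (∁ g)) (∁-involutive g)

  allOnesAndUnits-unique : s + s ≤ n → (S T : Subset (suc n)) → ∣ S ∣ ≤ s → ∣ T ∣ ≤ s →
    subsetSum (allOnesAndUnits n) S ≡ subsetSum (allOnesAndUnits n) T → S ≡ T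
  allOnesAndUnits-unique 2s≤n (false ∷ S) (false ∷ T) _ _ eq = cong (false ∷_) (begin
    S                                              ≡⟨ sym (subsetSum-allOnesAndUnits-false S) ⟩
    subsetSum (allOnesAndUnits _) (false ∷ S)      ≡⟨ eq ⟩
    subsetSum (allOnesAndUnits _) (false ∷ T)      ≡⟨ subsetSum-allOnesAndUnits-false T ⟩
    T                                              ∎)
    where open ≡-Reasoning
  allOnesAndUnits-unique 2s≤n (true ∷ S) (true ∷ T) _ _ eq = cong (true ∷_) (∁-injective (begin
    ∁ S                                            ≡⟨ sym (subsetSum-allOnesAndUnits-true S) ⟩
    subsetSum (allOnesAndUnits _) (true ∷ S)       ≡⟨ eq ⟩
    subsetSum (allOnesAndUnits _) (true ∷ T)       ≡⟨ subsetSum-allOnesAndUnits-true T ⟩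
    ∁ T                                            ∎))
    where open ≡-Reasoning
  allOnesAndUnits-unique 2s≤n (true ∷ S) (false ∷ T) ∣S∣<s ∣T∣≤s eq =
    contradiction (subst (λ v → ∣ v ∣ ≤ s) T≡∁S ∣T∣≤s) (∁-not-both-small 2s≤n S ∣S∣<s)
    where
    T≡∁S : T ≡ ∁ S
    T≡∁S = trans (sym (subsetSum-allOnesAndUnits-false T))
                 (trans (sym eq) (subsetSum-allOnesAndUnits-true S))
  allOnesAndUnits-unique 2s≤n (false ∷ S) (true ∷ T) ∣S∣≤s ∣T∣<s eq =
    sym (allOnesAndUnits-unique 2s≤n (true ∷ T) (false ∷ S) ∣T∣<s ∣S∣≤s (sym eq))

mainTheorem6 : (s : ℕ) → 1 ≤ s →
    Σ (Fin (suc (2 * s)) → Z2^ (2 * s)) (λ a → IsPerfectRestrictedBasis s a)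
mainTheorem6 s 1≤s =
  allOnesAndUnits (2 * s) ,
  allOnesAndUnits-injective (≤-trans (+-mono-≤ 1≤s 1≤s) (≤-reflexive (sym 2s≡s+s))) ,
  allOnesAndUnits-covers (≤-reflexive 2s≡s+s) ,
  allOnesAndUnits-unique (≤-reflexive (sym 2s≡s+s))
  where
  2s≡s+s : 2 * s ≡ s + s
  2s≡s+s = cong (s +_) (+-identityʳ s)
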